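{- Let $\mathcal{S}_{\mathcal{A}}$ and $\mathcal{S}_{\mathcal{B}}$ be finite bands with sets of chambers $\mathcal{C}_{\mathcal{A}}$ and $\mathcal{C}_{\mathcal{B}}$, respectively, and let $\phi:\mathcal{S}_{\mathcal{A}}\to\mathcal{S}_{\mathcal{B}}$ be an epimorphism of semigroups. Then (i) $\phi(\mathcal{C}_{\mathcal{A}})\subseteq\mathcal{C}_{\mathcal{B}}$; and (ii) if $\mathcal{S}_{\mathcal{A}}$ is left-regular, then $\phi(\mathcal{C}_{\mathcal{A}})=\mathcal{C}_{\mathcal{B}}$.
   Context: A band is a semigroup in which $x^2=x$ for all $x$. A band $\mathcal{S}$ is left-regular if $xyx=xy$ for all $x,y\in\mathcal{S}$. To a finite band $\mathcal{S}$ one associates a finite join semilattice $L$ (with maximum $\hat1$) and a surjective support map $\mathrm{supp}:\mathcal{S}\to L$ characterized by $\mathrm{supp}(x)\le_L\mathrm{supp}(y)\iff y=yxy$; the chambers of $\mathcal{S}$ are the elements $c$ with $\mathrm{supp}(c)=\hat1$, equivalently the elements $c$ with $c=cxc$ for all $x\in\mathcal{S}$. An epimorphism of semigroups is a surjective multiplicative map. -}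

module Defs where

open import Level using (Level; suc; _⊔_)
open import Data.Nat using (ℕ)
open import Data.Fin using (Fin)
open import Data.Product using (Σ; ∃; _×_; _,_)
open import Relation.Binary.PropositionalEquality using (_≡_)
open import Function.Bundles using (_↔_)

record FiniteBand (a : Level) : Set (suc a) where
  infixl 7 _∙_
  field
    Carrier : Set a
    size    : ℕ
    enum    : Fin size ↔ Carrier
    _∙_     : Carrier → Carrier → Carrier
    assoc   : ∀ x y z → (x ∙ y) ∙ z ≡ x ∙ (y ∙ z)
    idem    : ∀ x → x ∙ x ≡ x

open FiniteBand public

LeftRegular : ∀ {a} → FiniteBand a → Set a
LeftRegular S = ∀ x y → _∙_ S (_∙_ S x y) x ≡ _∙_ S x y

-- Chambers: elements c with c = c x c for all x
-- (equivalently supp c = 1̂, as in the paper's context).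
IsChamber : ∀ {a} (S : FiniteBand a) → Carrier S → Set a
IsChamber S c = ∀ x → c ≡ _∙_ S (_∙_ S c x) c

IsEpimorphism : ∀ {a b} (A : FiniteBand a) (B : FiniteBand b) →
                (Carrier A → Carrier B) → Set (a ⊔ b)
IsEpimorphism A B φ =
  (∀ x y → φ (_∙_ A x y) ≡ _∙_ B (φ x) (φ y)) ×
  (∀ y → ∃ λ x → φ x ≡ y)

-- (i) is the identity c x c = c pushed through φ, with surjectivity
-- supplying every element of B. (ii) In a left-regular band a product
-- p = x₁ ⋯ xₙ ⋯ absorbs each of its factors on the right (x y ⋯ x = x y ⋯),
-- so a product of u with all elements is a right-absorbing, hence chamber,
-- element c = u p with c = c u. If d = φ u is a chamber of B, then
-- φ c = φ u φ p φ u = d.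
module Submission where

open import Defs
open import Data.Product using (∃; _×_; _,_; proj₁; proj₂)
open import Data.List using (List; []; _∷_; map; allFin)
open import Data.List.Membership.Propositional using (_∈_)
open import Data.List.Membership.Propositional.Properties using (∈-map⁺; ∈-allFin)
open import Data.List.Relation.Unary.Any using (here; there)
open import Function.Bundles using (Inverse)
open import Relation.Binary.PropositionalEquality
  using (_≡_; refl; sym; trans; cong; subst; module ≡-Reasoning)

module _ {a} (S : FiniteBand a) where
  open FiniteBand S using () renaming (_∙_ to _·_)

  rightAbsorbing⇒chamber : ∀ c → (∀ x → c · x ≡ c) → IsChamber S c
  rightAbsorbing⇒chamber c absorbs x = sym (trans (cong (_· c) (absorbs x)) (idem S c))

  elements : List (Carrier S)
  elements = map (Inverse.to (enum S)) (allFin (size S))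

  ∈-elements : ∀ x → x ∈ elements
  ∈-elements x = subst (_∈ elements) (Inverse.strictlyInverseˡ (enum S) x)
    (∈-map⁺ (Inverse.to (enum S)) (∈-allFin (Inverse.from (enum S) x)))

  -- mulAll s [x₁, …, xₙ] = x₁ · (⋯ · (xₙ · s)); the seed s avoids needing a unit.
  mulAll : Carrier S → List (Carrier S) → Carrier S
  mulAll s []       = s
  mulAll s (x ∷ xs) = x · mulAll s xs

  chamberAbove : Carrier S → Carrier S
  chamberAbove u = mulAll u (u ∷ elements)

  module _ (leftRegular : LeftRegular S) where

    mulAll-absorbs : ∀ s xs {x} → x ∈ xs → mulAll s xs · x ≡ mulAll s xs
    mulAll-absorbs s (y ∷ xs) (here refl) = leftRegular y (mulAll s xs)
    mulAll-absorbs s (y ∷ xs) (there x∈xs) =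
      trans (assoc S y (mulAll s xs) _) (cong (y ·_) (mulAll-absorbs s xs x∈xs))

    chamberAbove-isChamber : ∀ u → IsChamber S (chamberAbove u)
    chamberAbove-isChamber u = rightAbsorbing⇒chamber (chamberAbove u)
      (λ x → mulAll-absorbs u (u ∷ elements) (there (∈-elements x)))

module _ {a b} (A : FiniteBand a) (B : FiniteBand b) (φ : Carrier A → Carrier B)
         (epi : IsEpimorphism A B φ) where
  open FiniteBand A using () renaming (_∙_ to _·_)
  open FiniteBand B using () renaming (_∙_ to _⋆_)
  open ≡-Reasoning

  private
    hom : ∀ x y → φ (x · y) ≡ φ x ⋆ φ y
    hom = proj₁ epi

    surj : ∀ y → ∃ λ x → φ x ≡ y
    surj = proj₂ epi

  epimorphism-preserves-chamber : ∀ c → IsChamber A c → IsChamber B (φ c)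
  epimorphism-preserves-chamber c c-chamber y with surj y
  ... | x , refl = begin
    φ c                   ≡⟨ cong φ (c-chamber x) ⟩
    φ ((c · x) · c)       ≡⟨ hom (c · x) c ⟩
    φ (c · x) ⋆ φ c       ≡⟨ cong (_⋆ φ c) (hom c x) ⟩
    (φ c ⋆ φ x) ⋆ φ c     ∎

  epimorphism-lifts-chamber : LeftRegular A →
    ∀ d → IsChamber B d → ∃ λ c → IsChamber A c × φ c ≡ d
  epimorphism-lifts-chamber leftRegular d d-chamber with surj d
  ... | u , refl = c , chamberAbove-isChamber A leftRegular u , φc≡φu
    where
    p : Carrier A
    p = mulAll A u (elements A)
    c : Carrier A
    c = chamberAbove A u

    φc≡φu : φ c ≡ φ u
    φc≡φu = begin
      φ c                   ≡⟨ cong φ (sym (leftRegular u p)) ⟩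
      φ (c · u)             ≡⟨ hom c u ⟩
      φ c ⋆ φ u             ≡⟨ cong (_⋆ φ u) (hom u p) ⟩
      (φ u ⋆ φ p) ⋆ φ u     ≡⟨ sym (d-chamber (φ p)) ⟩
      φ u                   ∎

lemma6p3 : ∀ {a b} (A : FiniteBand a) (B : FiniteBand b) (φ : Carrier A → Carrier B) →
    IsEpimorphism A B φ →
    (∀ c → IsChamber A c → IsChamber B (φ c)) ×
    (LeftRegular A → ∀ d → IsChamber B d → ∃ λ c → IsChamber A c × φ c ≡ d)
lemma6p3 A B φ epi =
  epimorphism-preserves-chamber A B φ epi , epimorphism-lifts-chamber A B φ epi
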